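{- Let $\mathcal{G}$ be a connected graph with vertices $v_1,\dots,v_n$, let $\alpha,\beta\in\mathbb{Z}^n$, and assume $\beta=T^\lambda(\alpha)$ for some $\lambda\in P_n$. Let $\mu$ be an integer partition with at most $n$ parts, viewed as $\mu=(\mu_1,\dots,\mu_n)\in\mathbb{N}^n$ with $\mu_1\ge\cdots\ge\mu_n$. Then all toppling sequences associated with standard Young tableaux of shape $\mu$ belong to $\mathcal{Y}_{\alpha,\beta}$ if and only if $\mu=\lambda+k(\epsilon_1+\epsilon_2+\cdots+\epsilon_n)$ for some $k\in\mathbb{N}$.
   Context: $\mathcal{G}=(V,E)$ is a connected graph with vertex set $V=\{v_1,\dots,v_n\}$, no loops and at most one edge between any two vertices. $\epsilon_i\in\mathbb{Z}^n$ is the $i$th standard basis vector, $d_i$ the degree of $v_i$, $\Delta_i=\big(\sum_{j:\{v_j,v_i\}\in E}\epsilon_j\big)-d_i\epsilon_i$, and $T_i(\alpha)=\alpha+\Delta_i$. For $a\in\mathbb{Z}^n$, $T^a=T_1^{a_1}\cdots T_n^{a_n}$. Toppling dominance: $\gamma\le\alpha$ iff $\gamma=T^\eta(\alpha)$ for some $\eta\in\mathbb{N}^n$ with $\eta_1\ge\cdots\ge\eta_n$. $P_n$ is the set of $\lambda\in\mathbb{N}^n$ with $\lambda_1\ge\cdots\ge\lambda_n=0$. A toppling sequence $(T_{i_1},\dots,T_{i_l})$ is an $\alpha,\beta$-toppling sequence if $\beta=T_{i_l}\cdots T_{i_1}(\alpha)$; $\mathcal{Y}_{\alpha,\beta}$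 is the set of $\alpha,\beta$-toppling sequences with $T_{i_k}\cdots T_{i_1}(\alpha)\le\alpha$ for all $1\le k\le l$. The toppling sequence associated with a standard Young tableau with $l$ boxes is $(T_{i_1},\dots,T_{i_l})$, where $i_m$ is the row containing the entry $m$. -}

module Defs where

open import Data.Nat as ℕ using (ℕ; zero; suc)
open import Data.Integer as ℤ using (ℤ; +_)
open import Data.Fin as Fin using (Fin; toℕ; fromℕ)
open import Data.Bool using (Bool; true; false; if_then_else_)
open import Data.List as List using (List; []; _∷_; length; take; lookup; allFin)
open import Data.Product using (Σ; ∃; _×_; _,_)
open import Relation.Nullary using (does)
open import Relation.Binary.PropositionalEquality using (_≡_)
open import Function using (_∘_)
open import Data.Nat.ListAction using (sum)

-- Simple connected graphs on vertex set Fin n (vertex v_{i+1} is i)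

data Reachable {n : ℕ} (adj : Fin n → Fin n → Bool) : Fin n → Fin n → Set where
  here : ∀ {i} → Reachable adj i i
  step : ∀ {i k j} → adj i k ≡ true → Reachable adj k j → Reachable adj i j

record ConnectedGraph (n : ℕ) : Set where
  field
    adj       : Fin n → Fin n → Bool
    symmetric : ∀ i j → adj i j ≡ adj j i
    noLoops   : ∀ i → adj i i ≡ false
    connected : ∀ i j → Reachable adj i j

open ConnectedGraph public

Config : ℕ → Set
Config n = Fin n → ℤ

indicator : Bool → ℕ
indicator true  = 1
indicator false = 0

degree : ∀ {n} → ConnectedGraph n → Fin n → ℕ
degree {n} G i = sum (List.map (λ j → indicator (adj G i j)) (allFin n))

Δ : ∀ {n} → ConnectedGraph n → Fin n → Config n
Δ G i j = + indicator (adj G i j) ℤ.- (if does (i Fin.≟ j) then + degree G i else + 0)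

T : ∀ {n} → ConnectedGraph n → Fin n → Config n → Config n
T G i α j = α j ℤ.+ Δ G i j

iter : ∀ {A : Set} → (A → A) → ℕ → A → A
iter f zero    x = x
iter f (suc k) x = f (iter f k x)

Tpow : ∀ {n} → ConnectedGraph n → (Fin n → ℕ) → Config n → Config n
Tpow {n} G a α = List.foldr (λ i acc → iter (T G i) (a i) acc) α (allFin n)

_≐_ : ∀ {n} → Config n → Config n → Set
γ ≐ α = ∀ j → γ j ≡ α j

Antitone : ∀ {n} → (Fin n → ℕ) → Set
Antitone {n} η = ∀ (i j : Fin n) → i Fin.≤ j → η j ℕ.≤ η i

Dominated : ∀ {n} → ConnectedGraph n → Config n → Config n → Set
Dominated {n} G γ α = Σ (Fin n → ℕ) λ η → Antitone η × (γ ≐ Tpow G η α)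

InP : ∀ {m} → (Fin (suc m) → ℕ) → Set
InP {m} lam = Antitone lam × lam (fromℕ m) ≡ 0

-- Toppling sequences (T_{i_1}, …, T_{i_l}) as lists [i_1, …, i_l]

applySeq : ∀ {n} → ConnectedGraph n → List (Fin n) → Config n → Config n
applySeq G []       α = α
applySeq G (i ∷ is) α = applySeq G is (T G i α)

InY : ∀ {n} → ConnectedGraph n → Config n → Config n → List (Fin n) → Set
InY G α β s =
  (β ≐ applySeq G s α) ×
  (∀ (k : ℕ) → k ℕ.< length s → Dominated G (applySeq G (take (suc k) s) α) α)

-- Standard Young tableaux of shape μ (μ weakly decreasing, rows indexed
-- by Fin n, boxes (i , j) with j < μ i, entries 1 … |μ|)

size : ∀ {n} → (Fin n → ℕ) → ℕ
size {n} μ = sum (List.map μ (allFin n))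

record SYT {n : ℕ} (μ : Fin n → ℕ) : Set where
  field
    entry     : Fin n → ℕ → ℕ
    inRange   : ∀ i j → j ℕ.< μ i → 1 ℕ.≤ entry i j × entry i j ℕ.≤ size μ
    injective : ∀ i j i' j' → j ℕ.< μ i → j' ℕ.< μ i' →
                entry i j ≡ entry i' j' → (i ≡ i') × (j ≡ j')
    surjective : ∀ m → 1 ℕ.≤ m → m ℕ.≤ size μ →
                 Σ (Fin n) λ i → Σ ℕ λ j → j ℕ.< μ i × entry i j ≡ m
    rowIncreasing : ∀ i j j' → j ℕ.< j' → j' ℕ.< μ i → entry i j ℕ.< entry i j'
    colIncreasing : ∀ i i' j → i Fin.< i' → j ℕ.< μ i' → entry i j ℕ.< entry i' j

open SYT public

AssociatedSeq : ∀ {n} {μ : Fin n → ℕ} → SYT μ → List (Fin n) → Set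
AssociatedSeq {μ = μ} t s =
  (length s ≡ size μ) ×
  (∀ (k : Fin (length s)) →
     Σ ℕ λ j → j ℕ.< μ (lookup s k) × entry t (lookup s k) j ≡ suc (toℕ k))

-- Firing vertex i x_i times translates a configuration by Σ x_i Δ_i, so both T^η and a toppling
-- sequence act by translation, the latter by its vector of occurrences. For the sequence of a standard
-- Young tableau of shape μ, the occurrence vector after k steps is the shape of the entries ≤ k; it is
-- again a partition, so every prefix is dominated by α, and the whole sequence realises T^μ. Hence the
-- sequences lie in 𝒴_{α,β} iff T^μ α = T^λ α, i.e. iff Σ (μ_i - λ_i) Δ_i = 0. On a connected graph
-- only constant firing vectors have zero effect (maximum principle), and λ_n = 0 makes the constant
-- μ_n ∈ ℕ. The row-reading tableau shows that such sequences exist, which the forward direction needs.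
module Submission where

open import Defs
open import Algebra.Bundles using (AbelianGroup)
open import Data.Bool using (true; false; if_then_else_)
open import Data.Empty using (⊥-elim)
open import Data.Fin as Fin using (Fin; zero; suc; toℕ; fromℕ; _≟_)
import Data.Fin.Properties as Fin
open import Data.Integer using (ℤ)
open import Data.List as List using (List; []; _∷_; length; take; lookup)
import Data.List.Properties as List
open import Data.Nat as ℕ using (ℕ; zero; suc)
import Data.Nat.ListAction as ListAction
open import Data.Product using (Σ; _×_; _,_; proj₁; proj₂)
open import Data.Sum using (_⊎_; inj₁; inj₂)
open import Function using (_∘_; id)
open import Function.Bundles using (_⇔_; mk⇔; Equivalence)
open import Relation.Binary using (tri<; tri≈; tri>)
open import Relation.Binary.PropositionalEquality
open import Relation.Nullary using (does; yes; no; ¬_)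

occurrences : ∀ {n} → List (Fin n) → Fin n → ℕ
occurrences []      i = 0
occurrences (r ∷ s) i = indicator (does (i ≟ r)) ℕ.+ occurrences s i

sum-map-allFin : ∀ {n} (f : Fin n → ℕ) →
  ListAction.sum (List.map f (List.allFin n)) ≡ ListAction.sum (List.tabulate f)
sum-map-allFin f = cong ListAction.sum (List.map-tabulate id f)

module _ where
  open import Data.Integer using (+_; 0ℤ; 1ℤ; _+_; _-_; _*_; _≤_)
  open import Data.Integer.Properties
    using (+-identityˡ; +-identityʳ; +-assoc; +-inverseʳ; +-injective; *-identityˡ; *-identityʳ; *-zeroʳ;
           *-distribʳ-+; ≤-refl; ≤-trans; ≤-reflexive; ≤-antisym; ≤-total; +-mono-≤; +-monoʳ-≤; i-j≡0⇒i≡j;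
           i≤j⇒i-j≤0; +-*-semiring; +-0-abelianGroup; module ≤-Reasoning)
  open import Data.Integer.Tactic.RingSolver using (solve-∀)
  open import Algebra.Properties.Semiring.Sum +-*-semiring
    using (sum-syntax; sum-cong-≗; sum-replicate-zero; sum-remove; ∑-distrib-+; *-distribˡ-sum)
  open import Algebra.Properties.Group (AbelianGroup.group +-0-abelianGroup) using (∙-cancelˡ; ∙-cancelʳ)

  +sum-tabulate : ∀ {n} (f : Fin n → ℕ) → + ListAction.sum (List.tabulate f) ≡ ∑[ i < n ] (+ f i)
  +sum-tabulate {zero}  f = refl
  +sum-tabulate {suc n} f = cong (_+_ (+ f zero)) (+sum-tabulate (f ∘ suc))

  ∑-if-≟ : ∀ {n} (j : Fin n) (f : Fin n → ℤ) →
    ∑[ i < n ] (if does (i ≟ j) then f i else 0ℤ) ≡ f j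
  ∑-if-≟ {suc n} zero    f = trans (cong (_+_ (f zero)) (sum-replicate-zero n)) (+-identityʳ _)
  ∑-if-≟ {suc n} (suc j) f = trans (+-identityˡ _) (∑-if-≟ j (f ∘ suc))

  ∑-nonpos : ∀ {n} (f : Fin n → ℤ) → (∀ i → f i ≤ 0ℤ) → ∑[ i < n ] f i ≤ 0ℤ
  ∑-nonpos {zero}  f f≤0 = ≤-refl
  ∑-nonpos {suc n} f f≤0 = +-mono-≤ (f≤0 zero) (∑-nonpos (f ∘ suc) (f≤0 ∘ suc))

  nonpos+nonpos≡0⇒≡0 : ∀ {a b} → a ≤ 0ℤ → b ≤ 0ℤ → a + b ≡ 0ℤ → a ≡ 0ℤ
  nonpos+nonpos≡0⇒≡0 {a} {b} a≤0 b≤0 a+b≡0 = ≤-antisym a≤0 (begin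
    0ℤ      ≡⟨ a+b≡0 ⟨
    a + b   ≤⟨ +-monoʳ-≤ a b≤0 ⟩
    a + 0ℤ  ≡⟨ +-identityʳ a ⟩
    a       ∎)
    where open ≤-Reasoning

  ∑-nonpos≡0⇒≡0 : ∀ {n} (f : Fin n → ℤ) → (∀ i → f i ≤ 0ℤ) → ∑[ i < n ] f i ≡ 0ℤ → ∀ i → f i ≡ 0ℤ
  ∑-nonpos≡0⇒≡0 {suc n} f f≤0 ∑f≡0 i =
    nonpos+nonpos≡0⇒≡0 (f≤0 i) (∑-nonpos _ (f≤0 ∘ Fin.punchIn i)) (trans (sym (sum-remove f)) ∑f≡0)

  i-j≡k-l⇒i+l≡j+k : ∀ i j k l → i - j ≡ k - l → i + l ≡ j + k
  i-j≡k-l⇒i+l≡j+k i j k l eq = begin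
    i + l                ≡⟨ regroup i j l ⟩
    j + ((i - j) + l)    ≡⟨ cong (λ d → j + (d + l)) eq ⟩
    j + ((k - l) + l)    ≡⟨ cancel j k l ⟩
    j + k                ∎
    where
    open ≡-Reasoning
    regroup : ∀ a b c → a + c ≡ b + ((a - b) + c)
    regroup = solve-∀
    cancel : ∀ a b c → a + ((b - c) + c) ≡ a + b
    cancel = solve-∀

  argmax : ∀ {m} (f : Fin (suc m) → ℤ) → Σ (Fin (suc m)) λ j → ∀ i → f i ≤ f j
  argmax {zero}  f = zero , λ { zero → ≤-refl }
  argmax {suc m} f with argmax (f ∘ suc)
  ... | j , max with ≤-total (f zero) (f (suc j))
  ...   | inj₁ f₀≤fⱼ = suc j , λ { zero → f₀≤fⱼ ; (suc i) → max i }
  ...   | inj₂ fⱼ≤f₀ = zero , λ { zero → ≤-refl ; (suc i) → ≤-trans (max i) fⱼ≤f₀ }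

  indicator-* : ∀ b d → + indicator b * d ≡ (if b then d else 0ℤ)
  indicator-* true  d = *-identityˡ d
  indicator-* false d = refl

  *-indicator-nonpos : ∀ {a} b → a ≤ 0ℤ → a * + indicator b ≤ 0ℤ
  *-indicator-nonpos {a} true  a≤0 = ≤-trans (≤-reflexive (*-identityʳ a)) a≤0
  *-indicator-nonpos {a} false a≤0 = ≤-reflexive (*-zeroʳ a)

  module _ {n} (G : ConnectedGraph n) where

    toppling : (Fin n → ℤ) → Config n
    toppling x j = ∑[ i < n ] (x i * Δ G i j)

    toppling-cong : ∀ {x y} → (∀ i → x i ≡ y i) → ∀ j → toppling x j ≡ toppling y j
    toppling-cong x≡y j = sum-cong-≗ (λ i → cong (_* Δ G i j) (x≡y i))

    toppling-+ : ∀ x y j → toppling (λ i → x i + y i) j ≡ toppling x j + toppling y j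
    toppling-+ x y j = trans (sum-cong-≗ (λ i → *-distribʳ-+ (Δ G i j) (x i) (y i)))
                               (∑-distrib-+ (λ i → x i * Δ G i j) (λ i → y i * Δ G i j))

    toppling-basis : ∀ r j → toppling (λ i → + indicator (does (i ≟ r))) j ≡ Δ G r j
    toppling-basis r j =
      trans (sum-cong-≗ (λ i → indicator-* (does (i ≟ r)) (Δ G i j))) (∑-if-≟ r (λ i → Δ G i j))

    +degree : ∀ j → + degree G j ≡ ∑[ i < n ] (+ indicator (adj G j i))
    +degree j = trans (cong +_ (sum-map-allFin (indicator ∘ adj G j))) (+sum-tabulate (indicator ∘ adj G j))

    -- Adding x_j d_j to both sides cancels the diagonal part of Δ, and d_j = Σ_i a_ji spreads it
    -- over the neighbours.
    toppling-neighbours : ∀ x j → toppling x j ≡ ∑[ i < n ] ((x i - x j) * + indicator (adj G j i))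
    toppling-neighbours x j = ∙-cancelʳ (x j * + degree G j) _ _ (begin
        toppling x j + x j * + degree G j
      ≡⟨ cong (_+_ (toppling x j)) (∑-if-≟ j (λ i → x i * + degree G i)) ⟨
        toppling x j + ∑[ i < n ] (if does (i ≟ j) then x i * + degree G i else 0ℤ)
      ≡⟨ ∑-distrib-+ (λ i → x i * Δ G i j) _ ⟨
        ∑[ i < n ] (x i * Δ G i j + (if does (i ≟ j) then x i * + degree G i else 0ℤ))
      ≡⟨ sum-cong-≗ (λ i → trans (remove-diagonal (does (i ≟ j)) (x i) _ _)
                                  (cong (λ b → x i * + indicator b) (symmetric G i j))) ⟩
        ∑[ i < n ] (x i * a i)
      ≡⟨ sum-cong-≗ (λ i → split (x i) (x j) (a i)) ⟩
        ∑[ i < n ] ((x i - x j) * a i + x j * a i)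
      ≡⟨ ∑-distrib-+ (λ i → (x i - x j) * a i) (λ i → x j * a i) ⟩
        ∑[ i < n ] ((x i - x j) * a i) + ∑[ i < n ] (x j * a i)
      ≡⟨ cong (_+_ (∑[ i < n ] ((x i - x j) * a i))) (*-distribˡ-sum (x j) a) ⟨
        ∑[ i < n ] ((x i - x j) * a i) + x j * ∑[ i < n ] a i
      ≡⟨ cong (λ d → ∑[ i < n ] ((x i - x j) * a i) + x j * d) (+degree j) ⟨
        ∑[ i < n ] ((x i - x j) * a i) + x j * + degree G j ∎)
      where
      open ≡-Reasoning
      a : Fin n → ℤ
      a i = + indicator (adj G j i)
      remove-diagonal : ∀ b x a d → x * (a - (if b then d else 0ℤ)) + (if b then x * d else 0ℤ) ≡ x * a
      remove-diagonal true  x a d = on-diagonal x a d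
        where
        on-diagonal : ∀ x a d → x * (a - d) + x * d ≡ x * a
        on-diagonal = solve-∀
      remove-diagonal false x a d = trans (+-identityʳ _) (cong (x *_) (+-identityʳ a))
      split : ∀ x y a → x * a ≡ (x - y) * a + y * a
      split = solve-∀

    toppling-const : ∀ c j → toppling (λ _ → c) j ≡ 0ℤ
    toppling-const c j = trans (toppling-neighbours (λ _ → c) j)
      (trans (sum-cong-≗ (λ i → cong (λ d → d * + indicator (adj G j i)) (+-inverseʳ c)))
             (sum-replicate-zero n))

    max-neighbour : ∀ x j → (∀ i → x i ≤ x j) → toppling x j ≡ 0ℤ → ∀ i → adj G j i ≡ true → x i ≡ x j
    max-neighbour x j max top≡0 i j~i = i-j≡0⇒i≡j _ _ (begin
      x i - x j                              ≡⟨ *-identityʳ _ ⟨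
      (x i - x j) * + indicator true         ≡⟨ cong (λ b → (x i - x j) * + indicator b) j~i ⟨
      (x i - x j) * + indicator (adj G j i)  ≡⟨ ∑-nonpos≡0⇒≡0 _ terms≤0 ∑terms≡0 i ⟩
      0ℤ                                     ∎)
      where
      open ≡-Reasoning
      terms≤0 : ∀ k → (x k - x j) * + indicator (adj G j k) ≤ 0ℤ
      terms≤0 k = *-indicator-nonpos (adj G j k) (i≤j⇒i-j≤0 (max k))
      ∑terms≡0 : ∑[ k < n ] ((x k - x j) * + indicator (adj G j k)) ≡ 0ℤ
      ∑terms≡0 = trans (sym (toppling-neighbours x j)) top≡0

    max-reachable : ∀ x → (∀ j → toppling x j ≡ 0ℤ) → ∀ {j i} → Reachable (adj G) j i →
      (∀ k → x k ≤ x j) → x i ≡ x j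
    max-reachable x harmonic here                 max = refl
    max-reachable x harmonic (step {k = k} j~k k⇝i) max =
      trans (max-reachable x harmonic k⇝i (λ l → subst (x l ≤_) (sym xk≡xj) (max l))) xk≡xj
      where
      xk≡xj : x k ≡ x _
      xk≡xj = max-neighbour x _ max (harmonic _) k j~k

    iter-T : ∀ i k α j → iter (T G i) k α j ≡ α j + + k * Δ G i j
    iter-T i zero    α j = sym (+-identityʳ (α j))
    iter-T i (suc k) α j = trans (cong (λ a → a + Δ G i j) (iter-T i k α j)) (one-more (α j) (+ k) (Δ G i j))
      where
      one-more : ∀ a k d → (a + k * d) + d ≡ a + (1ℤ + k) * d
      one-more = solve-∀

    foldr-iter-T : ∀ {k} (η : Fin n → ℕ) (g : Fin k → Fin n) α j →
      List.foldr (λ i → iter (T G i) (η i)) α (List.tabulate g) j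
        ≡ α j + ∑[ i < k ] (+ η (g i) * Δ G (g i) j)
    foldr-iter-T {zero}  η g α j = sym (+-identityʳ (α j))
    foldr-iter-T {suc k} η g α j = begin
      List.foldr (λ i → iter (T G i) (η i)) α (List.tabulate g) j
        ≡⟨ iter-T (g zero) (η (g zero)) _ j ⟩
      List.foldr (λ i → iter (T G i) (η i)) α (List.tabulate (g ∘ suc)) j + + η (g zero) * Δ G (g zero) j
        ≡⟨ cong (λ a → a + + η (g zero) * Δ G (g zero) j) (foldr-iter-T η (g ∘ suc) α j) ⟩
      α j + ∑[ i < k ] (+ η (g (suc i)) * Δ G (g (suc i)) j) + + η (g zero) * Δ G (g zero) j
        ≡⟨ swap (α j) _ _ ⟩
      α j + ∑[ i < suc k ] (+ η (g i) * Δ G (g i) j) ∎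
      where
      open ≡-Reasoning
      swap : ∀ a s t → (a + s) + t ≡ a + (t + s)
      swap = solve-∀

    Tpow-toppling : ∀ η α j → Tpow G η α j ≡ α j + toppling (λ i → + η i) j
    Tpow-toppling η α j = foldr-iter-T η id α j

    applySeq-toppling : ∀ s α j → applySeq G s α j ≡ α j + toppling (λ i → + occurrences s i) j
    applySeq-toppling []      α j = sym (trans (cong (_+_ (α j)) (toppling-const 0ℤ j)) (+-identityʳ (α j)))
    applySeq-toppling (r ∷ s) α j = begin
      applySeq G s (T G r α) j
        ≡⟨ applySeq-toppling s (T G r α) j ⟩
      (α j + Δ G r j) + toppling (λ i → + occurrences s i) j
        ≡⟨ +-assoc (α j) _ _ ⟩
      α j + (Δ G r j + toppling (λ i → + occurrences s i) j)
        ≡⟨ cong (λ d → α j + (d + _)) (toppling-basis r j) ⟨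
      α j + (toppling (λ i → + indicator (does (i ≟ r))) j + toppling (λ i → + occurrences s i) j)
        ≡⟨ cong (_+_ (α j)) (toppling-+ (λ i → + indicator (does (i ≟ r))) (λ i → + occurrences s i) j) ⟨
      α j + toppling (λ i → + occurrences (r ∷ s) i) j ∎
      where open ≡-Reasoning

    Tpow-shift : ∀ {μ η : Fin n → ℕ} {k} → (∀ i → μ i ≡ η i ℕ.+ k) → ∀ α → Tpow G μ α ≐ Tpow G η α
    Tpow-shift {μ} {η} {k} μ≡η+k α j = begin
      Tpow G μ α j                     ≡⟨ Tpow-toppling μ α j ⟩
      α j + toppling (λ i → + μ i) j   ≡⟨ cong (_+_ (α j)) same-effect ⟩
      α j + toppling (λ i → + η i) j   ≡⟨ Tpow-toppling η α j ⟨
      Tpow G η α j                     ∎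
      where
      open ≡-Reasoning
      same-effect : toppling (λ i → + μ i) j ≡ toppling (λ i → + η i) j
      same-effect = begin
        toppling (λ i → + μ i) j                ≡⟨ toppling-cong (λ i → cong +_ (μ≡η+k i)) j ⟩
        toppling (λ i → + η i + + k) j          ≡⟨ toppling-+ (λ i → + η i) (λ _ → + k) j ⟩
        Lη + toppling (λ _ → + k) j             ≡⟨ cong (_+_ Lη) (toppling-const (+ k) j) ⟩
        Lη + 0ℤ                                 ≡⟨ +-identityʳ Lη ⟩
        Lη                                      ∎
        where
        Lη : ℤ
        Lη = toppling (λ i → + η i) j

    applySeq-Tpow : ∀ s {η} → (∀ i → occurrences s i ≡ η i) → ∀ α → applySeq G s α ≐ Tpow G η α
    applySeq-Tpow s {η} occ≡η α j = begin
      applySeq G s α j                              ≡⟨ applySeq-toppling s α j ⟩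
      α j + toppling (λ i → + occurrences s i) j    ≡⟨ cong (_+_ (α j)) (toppling-cong (λ i → cong +_ (occ≡η i)) j) ⟩
      α j + toppling (λ i → + η i) j                ≡⟨ Tpow-toppling η α j ⟨
      Tpow G η α j                                  ∎
      where open ≡-Reasoning

    applySeq-dominated : ∀ s α → Antitone (occurrences s) → Dominated G (applySeq G s α) α
    applySeq-dominated s α antitone = occurrences s , antitone , applySeq-Tpow s (λ _ → refl) α

  toppling≡0⇒constant : ∀ {m} (G : ConnectedGraph (suc m)) x → (∀ j → toppling G x j ≡ 0ℤ) →
    ∀ i i′ → x i ≡ x i′
  toppling≡0⇒constant G x harmonic i i′ with argmax x
  ... | j , max = trans (max-reachable G x harmonic (connected G j i) max)
                        (sym (max-reachable G x harmonic (connected G j i′) max))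

  Tpow-≐⇒shift : ∀ {m} (G : ConnectedGraph (suc m)) {μ η : Fin (suc m) → ℕ} α →
    Tpow G μ α ≐ Tpow G η α → ∀ i i′ → μ i ℕ.+ η i′ ≡ η i ℕ.+ μ i′
  Tpow-≐⇒shift G {μ} {η} α Tμ≐Tη i i′ =
    +-injective (i-j≡k-l⇒i+l≡j+k (+ μ i) (+ η i) (+ μ i′) (+ η i′) (toppling≡0⇒constant G x harmonic i i′))
    where
    x : Fin _ → ℤ
    x i = + μ i - + η i
    harmonic : ∀ j → toppling G x j ≡ 0ℤ
    harmonic j = ∙-cancelˡ (toppling G (λ i → + η i) j) _ _ (begin
      toppling G (λ i → + η i) j + toppling G x j   ≡⟨ toppling-+ G (λ i → + η i) x j ⟨
      toppling G (λ i → + η i + x i) j             ≡⟨ toppling-cong G (λ i → recombine (+ μ i) (+ η i)) j ⟨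
      toppling G (λ i → + μ i) j                   ≡⟨ ∙-cancelˡ (α j) _ _ (trans (sym (Tpow-toppling G μ α j))
                                                          (trans (Tμ≐Tη j) (Tpow-toppling G η α j))) ⟩
      toppling G (λ i → + η i) j                   ≡⟨ +-identityʳ _ ⟨
      toppling G (λ i → + η i) j + 0ℤ              ∎)
      where
      open ≡-Reasoning
      recombine : ∀ a b → a ≡ b + (a - b)
      recombine = solve-∀

-- Opened only now: the integer section above uses the same operator names.
open import Data.Nat using (_+_; _∸_; _≤_; _<_; _<?_; z≤n; s≤s)
open import Data.Nat.Properties
  using (≤-refl; ≤-reflexive; ≤-trans; ≤-antisym; <-irrefl; <-trans; <-≤-trans; <⇒≤; ≤-pred; ≮⇒≥; n≮0;
         m≤n⇒m<n∨m≡n; m≤n⇒m≤1+n; m≤m+n; +-identityʳ; +-comm; +-assoc; +-monoʳ-≤; +-monoʳ-<; +-cancelˡ-≡;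
         ∸-monoˡ-<; m+n∸m≡n; m+[n∸m]≡n; suc-injective)

module _ {n} {μ : Fin n → ℕ} (t : SYT μ) where
  open Equivalence using (to; from)

  FilledShape : ℕ → (Fin n → ℕ) → Set
  FilledShape k c = ∀ i → c i ≤ μ i × (∀ j → j < μ i → (j < c i ⇔ entry t i j ≤ k))

  filledShape-zero : FilledShape 0 (λ _ → 0)
  filledShape-zero i =
    z≤n , λ j j<μ → mk⇔ (λ ()) (λ e≤0 → ⊥-elim (n≮0 (≤-trans (proj₁ (inRange t i j j<μ)) e≤0)))

  module _ {k c r j₀} (shape : FilledShape k c) (j₀<μ : j₀ < μ r) (entry≡ : entry t r j₀ ≡ suc k) where

    next-box : j₀ ≡ c r
    next-box = ≤-antisym (≮⇒≥ c<j₀-impossible) (≮⇒≥ j₀<c-impossible)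
      where
      j₀<c-impossible : ¬ j₀ < c r
      j₀<c-impossible j₀<c = <-irrefl refl (subst (_≤ k) entry≡ (to (proj₂ (shape r) j₀ j₀<μ) j₀<c))
      c<j₀-impossible : ¬ c r < j₀
      c<j₀-impossible c<j₀ = <-irrefl refl (from (proj₂ (shape r) (c r) c<μ)
        (≤-pred (subst (entry t r (c r) <_) entry≡ (rowIncreasing t r (c r) j₀ c<j₀ j₀<μ))))
        where
        c<μ : c r < μ r
        c<μ = <-trans c<j₀ j₀<μ

    entry≤suc-cases : ∀ i j → j < μ i → entry t i j ≤ suc k → entry t i j ≤ k ⊎ (i ≡ r × j ≡ j₀)
    entry≤suc-cases i j j<μ e≤ with m≤n⇒m<n∨m≡n e≤
    ... | inj₁ e<k+1 = inj₁ (≤-pred e<k+1)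
    ... | inj₂ e≡k+1 = inj₂ (injective t i j r j₀ j<μ j₀<μ (trans e≡k+1 (sym entry≡)))

    grown-row : ∀ j → j < μ r → (j < suc (c r) ⇔ entry t r j ≤ suc k)
    grown-row j j<μ = mk⇔ to′ from′
      where
      to′ : j < suc (c r) → entry t r j ≤ suc k
      to′ j<c+1 with m≤n⇒m<n∨m≡n (≤-pred j<c+1)
      ... | inj₁ j<c = m≤n⇒m≤1+n (to (proj₂ (shape r) j j<μ) j<c)
      ... | inj₂ j≡c = subst (_≤ suc k) (cong (entry t r) (trans next-box (sym j≡c))) (≤-reflexive entry≡)
      from′ : entry t r j ≤ suc k → j < suc (c r)
      from′ e≤ with entry≤suc-cases r j j<μ e≤
      ... | inj₁ e≤k          = m≤n⇒m≤1+n (from (proj₂ (shape r) j j<μ) e≤k)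
      ... | inj₂ (_ , j≡j₀)   = s≤s (≤-reflexive (trans j≡j₀ next-box))

    other-row : ∀ i → ¬ i ≡ r → ∀ j → j < μ i → (j < c i ⇔ entry t i j ≤ suc k)
    other-row i i≢r j j<μ = mk⇔ (m≤n⇒m≤1+n ∘ to (proj₂ (shape i) j j<μ)) from′
      where
      from′ : entry t i j ≤ suc k → j < c i
      from′ e≤ with entry≤suc-cases i j j<μ e≤
      ... | inj₁ e≤k        = from (proj₂ (shape i) j j<μ) e≤k
      ... | inj₂ (i≡r , _)  = ⊥-elim (i≢r i≡r)

    filledShape-suc : ∀ {c′} → (∀ i → c′ i ≡ c i + indicator (does (i ≟ r))) → FilledShape (suc k) c′
    filledShape-suc {c′} c′≡ i with i ≟ r | c′≡ i
    ... | yes refl | c′≡c+1 rewrite c′≡c+1 | +-comm (c i) 1 =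
      subst (_< μ i) next-box j₀<μ , grown-row
    ... | no i≢r   | c′≡c+0 rewrite c′≡c+0 | +-identityʳ (c i) =
      proj₁ (shape i) , other-row i i≢r

  filledShape-antitone : Antitone μ → ∀ {k c} → FilledShape k c → Antitone c
  filledShape-antitone μ-antitone {k} {c} shape i i′ i≤i′ = ≮⇒≥ cᵢ<cᵢ′-impossible
    where
    cᵢ<cᵢ′-impossible : ¬ c i < c i′
    cᵢ<cᵢ′-impossible cᵢ<cᵢ′ with m≤n⇒m<n∨m≡n i≤i′
    ... | inj₂ i≡i′ rewrite Fin.toℕ-injective i≡i′ = <-irrefl refl cᵢ<cᵢ′
    ... | inj₁ i<i′ = <-irrefl refl (from (proj₂ (shape i) (c i) cᵢ<μᵢ)
                        (<⇒≤ (<-≤-trans (colIncreasing t i i′ (c i) i<i′ cᵢ<μᵢ′)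
                                        (to (proj₂ (shape i′) (c i) cᵢ<μᵢ′) cᵢ<cᵢ′))))
      where
      cᵢ<μᵢ′ : c i < μ i′
      cᵢ<μᵢ′ = <-≤-trans cᵢ<cᵢ′ (proj₁ (shape i′))
      cᵢ<μᵢ : c i < μ i
      cᵢ<μᵢ = <-≤-trans cᵢ<μᵢ′ (μ-antitone i i′ i≤i′)

  filledShape-full : ∀ {c} → FilledShape (size μ) c → ∀ i → c i ≡ μ i
  filledShape-full {c} shape i = ≤-antisym (proj₁ (shape i)) (≮⇒≥ c<μ-impossible)
    where
    c<μ-impossible : ¬ c i < μ i
    c<μ-impossible c<μ = <-irrefl refl (from (proj₂ (shape i) (c i) c<μ) (proj₂ (inRange t i (c i) c<μ)))

  occurrences-take-suc : ∀ (s : List (Fin n)) k (k<len : k < length s) i →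
    occurrences (take (suc k) s) i
      ≡ occurrences (take k s) i + indicator (does (i ≟ lookup s (Fin.fromℕ< k<len)))
  occurrences-take-suc (r ∷ s) zero    _           i = +-identityʳ _
  occurrences-take-suc (r ∷ s) (suc k) (s≤s k<len) i =
    trans (cong (_+_ (indicator (does (i ≟ r)))) (occurrences-take-suc s k k<len i))
          (sym (+-assoc (indicator (does (i ≟ r))) _ _))

  associated-filledShape : ∀ s → AssociatedSeq t s → ∀ k → k ≤ length s →
    FilledShape k (occurrences (take k s))
  associated-filledShape s assoc zero    _     = filledShape-zero
  associated-filledShape s assoc (suc k) k<len with proj₂ assoc (Fin.fromℕ< k<len)
  ... | _ , j<μ , entry≡ =
    filledShape-suc (associated-filledShape s assoc k (<⇒≤ k<len)) j<μ
      (trans entry≡ (cong suc (Fin.toℕ-fromℕ< k<len))) (occurrences-take-suc s k k<len)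

  associated-occurrences : ∀ s → AssociatedSeq t s → ∀ i → occurrences s i ≡ μ i
  associated-occurrences s assoc i = begin
    occurrences s i                     ≡⟨ cong (λ s′ → occurrences s′ i) (List.take-all (length s) s ≤-refl) ⟨
    occurrences (take (length s) s) i   ≡⟨ filledShape-full full i ⟩
    μ i                                 ∎
    where
    open ≡-Reasoning
    full : FilledShape (size μ) (occurrences (take (length s) s))
    full = subst (λ k → FilledShape k (occurrences (take (length s) s))) (proj₁ assoc)
                 (associated-filledShape s assoc (length s) ≤-refl)

  associatedSeq : Σ (List (Fin n)) (AssociatedSeq t)
  associatedSeq = List.tabulate row , List.length-tabulate row , box-at
    where
    BoxInRow : ℕ → Fin n → Set
    BoxInRow m i = Σ ℕ λ j → j < μ i × entry t i j ≡ m
    box : (k : Fin (size μ)) → Σ (Fin n) (BoxInRow (suc (toℕ k)))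
    box k = surjective t (suc (toℕ k)) (s≤s z≤n) (Fin.toℕ<n k)
    row : Fin (size μ) → Fin n
    row k = proj₁ (box k)
    box-at : ∀ k → BoxInRow (suc (toℕ k)) (lookup (List.tabulate row) k)
    box-at k = subst (BoxInRow (suc (toℕ k))) (sym lookup≡)
      (subst (λ m → BoxInRow (suc m) (row k′)) (Fin.toℕ-cast len≡ k) (proj₂ (box k′)))
      where
      len≡ : length (List.tabulate row) ≡ size μ
      len≡ = List.length-tabulate row
      k′ : Fin (size μ)
      k′ = Fin.cast len≡ k
      lookup≡ : lookup (List.tabulate row) k ≡ row k′
      lookup≡ = trans (cong (lookup (List.tabulate row)) (sym (Fin.cast-involutive (sym len≡) len≡ k)))
                      (List.lookup-tabulate row k′)

rowOffset : ∀ {n} → (Fin n → ℕ) → Fin n → ℕ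
rowOffset μ zero    = 0
rowOffset μ (suc i) = μ zero + rowOffset (μ ∘ suc) i

size-suc : ∀ {n} (μ : Fin (suc n) → ℕ) → size μ ≡ μ zero + size (μ ∘ suc)
size-suc μ = trans (sum-map-allFin μ) (cong (μ zero +_) (sym (sum-map-allFin (μ ∘ suc))))

rowOffset+length≤size : ∀ {n} (μ : Fin n → ℕ) i → rowOffset μ i + μ i ≤ size μ
rowOffset+length≤size μ zero    = subst (μ zero ≤_) (sym (size-suc μ)) (m≤m+n _ _)
rowOffset+length≤size μ (suc i) = subst (_≤ size μ) (sym (+-assoc (μ zero) _ _))
  (subst (μ zero + (rowOffset (μ ∘ suc) i + μ (suc i)) ≤_) (sym (size-suc μ))
    (+-monoʳ-≤ (μ zero) (rowOffset+length≤size (μ ∘ suc) i)))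

rowOffset+length≤rowOffset : ∀ {n} (μ : Fin n → ℕ) {i i′} → i Fin.< i′ →
  rowOffset μ i + μ i ≤ rowOffset μ i′
rowOffset+length≤rowOffset μ {zero}  {suc i′} _          = m≤m+n _ _
rowOffset+length≤rowOffset μ {suc i} {suc i′} (s≤s i<i′) =
  subst (_≤ rowOffset μ (suc i′)) (sym (+-assoc (μ zero) _ _))
    (+-monoʳ-≤ (μ zero) (rowOffset+length≤rowOffset (μ ∘ suc) i<i′))

rowOffset-decompose : ∀ {n} (μ : Fin n → ℕ) m → m < size μ →
  Σ (Fin n) λ i → Σ ℕ λ j → j < μ i × rowOffset μ i + j ≡ m
rowOffset-decompose {zero}  μ m ()
rowOffset-decompose {suc n} μ m m<size with m <? μ zero
... | yes m<μ₀ = zero , m , m<μ₀ , refl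
... | no  m≮μ₀ = suc (proj₁ rest) , proj₁ (proj₂ rest) , proj₁ (proj₂ (proj₂ rest)) ,
    trans (+-assoc (μ zero) _ _) (trans (cong (μ zero +_) (proj₂ (proj₂ (proj₂ rest)))) (m+[n∸m]≡n μ₀≤m))
  where
  μ₀≤m : μ zero ≤ m
  μ₀≤m = ≮⇒≥ m≮μ₀
  rest = rowOffset-decompose (μ ∘ suc) (m ∸ μ zero)
    (subst (m ∸ μ zero <_) (m+n∸m≡n (μ zero) _) (∸-monoˡ-< (subst (m <_) (size-suc μ) m<size) μ₀≤m))

rowReading : ∀ {n} {μ : Fin n → ℕ} → Antitone μ → SYT μ
rowReading {n} {μ} μ-antitone = record
  { entry         = label
  ; inRange       = λ i j j<μ → s≤s z≤n , ≤-trans (+-monoʳ-< (rowOffset μ i) j<μ) (rowOffset+length≤size μ i)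
  ; injective     = injective′
  ; surjective    = λ { (suc m) _ m<size → let (i , j , j<μ , e) = rowOffset-decompose μ m m<size
                                           in i , j , j<μ , cong suc e }
  ; rowIncreasing = λ i j j′ j<j′ _ → s≤s (+-monoʳ-< (rowOffset μ i) j<j′)
  ; colIncreasing = λ i i′ j i<i′ j<μ′ → s≤s (earlier-row i<i′ (<-≤-trans j<μ′ (μ-antitone i i′ (<⇒≤ i<i′))))
  }
  where
  label : Fin n → ℕ → ℕ
  label i j = suc (rowOffset μ i + j)
  earlier-row : ∀ {i i′ j j′} → i Fin.< i′ → j < μ i → rowOffset μ i + j < rowOffset μ i′ + j′
  earlier-row {i} {i′} {j} {j′} i<i′ j<μ =
    <-≤-trans (+-monoʳ-< (rowOffset μ i) j<μ) (≤-trans (rowOffset+length≤rowOffset μ i<i′) (m≤m+n _ j′))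
  injective′ : ∀ i j i′ j′ → j < μ i → j′ < μ i′ → label i j ≡ label i′ j′ → i ≡ i′ × j ≡ j′
  injective′ i j i′ j′ j<μ j′<μ′ e with Fin.<-cmp i i′
  ... | tri< i<i′ _ _    = ⊥-elim (<-irrefl (suc-injective e) (earlier-row i<i′ j<μ))
  ... | tri> _ _ i′<i    = ⊥-elim (<-irrefl (sym (suc-injective e)) (earlier-row i′<i j′<μ′))
  ... | tri≈ _ refl _    = refl , +-cancelˡ-≡ (rowOffset μ i) _ _ (suc-injective e)

associated-InY : ∀ {n} (G : ConnectedGraph n) {μ : Fin n → ℕ} → Antitone μ → (t : SYT μ) (s : List (Fin n)) →
  AssociatedSeq t s → ∀ α β → β ≐ Tpow G μ α → InY G α β s
associated-InY G μ-antitone t s assoc α β β≐T^μ =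
  (λ j → trans (β≐T^μ j) (sym (applySeq-Tpow G s (associated-occurrences t s assoc) α j))) ,
  (λ k k<len → applySeq-dominated G (take (suc k) s) α
                 (filledShape-antitone t μ-antitone (associated-filledShape t s assoc (suc k) k<len)))

mainTheorem4 : (m : ℕ) (G : ConnectedGraph (suc m)) (α β : Config (suc m))
    (lam : Fin (suc m) → ℕ) → InP lam → β ≐ Tpow G lam α →
    (μ : Fin (suc m) → ℕ) → Antitone μ →
    ((t : SYT μ) (s : List (Fin (suc m))) → AssociatedSeq t s → InY G α β s)
      ⇔ Σ ℕ (λ k → ∀ i → μ i ≡ lam i + k)
mainTheorem4 m G α β lam (_ , lam-last≡0) β≐T^lam μ μ-antitone = mk⇔ shift-of-lam all-associated-InY
  where
  rowTableau : SYT μ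
  rowTableau = rowReading μ-antitone

  all-associated-InY : Σ ℕ (λ k → ∀ i → μ i ≡ lam i + k) → ∀ t s → AssociatedSeq t s → InY G α β s
  all-associated-InY (k , μ≡lam+k) t s assoc = associated-InY G μ-antitone t s assoc α β
    (λ j → trans (β≐T^lam j) (sym (Tpow-shift G {η = lam} {k} μ≡lam+k α j)))

  shift-of-lam : (∀ t s → AssociatedSeq t s → InY G α β s) → Σ ℕ (λ k → ∀ i → μ i ≡ lam i + k)
  shift-of-lam all-InY with associatedSeq rowTableau
  ... | s , assoc = μ (fromℕ m) , λ i → begin
    μ i                  ≡⟨ +-identityʳ (μ i) ⟨
    μ i + 0              ≡⟨ cong (μ i +_) lam-last≡0 ⟨
    μ i + lam (fromℕ m)  ≡⟨ Tpow-≐⇒shift G {μ} {lam} α T^μ≐T^lam i (fromℕ m) ⟩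
    lam i + μ (fromℕ m)  ∎
    where
    open ≡-Reasoning
    T^μ≐T^lam : Tpow G μ α ≐ Tpow G lam α
    T^μ≐T^lam j = trans (sym (applySeq-Tpow G s (associated-occurrences rowTableau s assoc) α j))
                    (trans (sym (proj₁ (all-InY rowTableau s assoc) j)) (β≐T^lam j))
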